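{- Let $H$ be a finite simple graph whose vertex set is partitioned into a clique $C$ and a set $D$ such that for every pair of distinct vertices $u,v\in C$ there is a vertex $w\in D$ adjacent to exactly one of $u$ and $v$. Then there exists a weight function $c_H:V(H)\to\mathbb{Z}_{\geqslant 0}$ such that $c_H(v)=1$ for all $v\in C$, $\sum_{v\in D}c_H(v)=|C|-1$, and every set $X\subseteq V(H)$ that intersects every distinguishing $P_3$ of $H$ satisfies $c_H(X)\geqslant |C|-1$. In particular, $\mathrm{OPT}(H,c_H)\geqslant |C|-1$.
   Context: A distinguishing $P_3$ of $H$ is an induced subgraph of $H$ on vertices $u,v,w$ where $uv$ is an edge and $w$ is adjacent to exactly one of $u,v$ (i.e. an induced path on three vertices containing the edge $uv$). For $X\subseteq V(H)$, $c_H(X)=\sum_{v\in X}c_H(v)$. A hitting set of $H$ is a set $X\subseteq V(H)$ such that $H-X$ has no induced subgraph isomorphic to $P_3$, and $\mathrm{OPT}(H,c_H)$ is the minimum of $c_H(X)$ over all hitting sets $X$ of $H$. -}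

module Defs where

open import Data.Nat using (ℕ; zero; suc; _+_; _∸_; _≥_)
open import Data.Fin using (Fin; zero; suc)
open import Data.Bool using (Bool; true; false; if_then_else_)
open import Data.Product using (_×_; Σ; ∃; ∃-syntax; _,_)
open import Data.Sum using (_⊎_)
open import Relation.Nullary using (¬_; Dec)
open import Relation.Binary.PropositionalEquality using (_≡_; _≢_)

record Graph (n : ℕ) : Set₁ where
  field
    Adj   : Fin n → Fin n → Set
    adj?  : ∀ u v → Dec (Adj u v)
    sym   : ∀ {u v} → Adj u v → Adj v u
    irrefl : ∀ {u} → ¬ Adj u u
open Graph public

VSet : ℕ → Set
VSet n = Fin n → Bool

_∈ₛ_ : ∀ {n} → Fin n → VSet n → Set
v ∈ₛ S = S v ≡ true

_∉ₛ_ : ∀ {n} → Fin n → VSet n → Set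
v ∉ₛ S = S v ≡ false

ΣFin : ∀ n → (Fin n → ℕ) → ℕ
ΣFin zero    f = 0
ΣFin (suc n) f = f zero + ΣFin n (λ i → f (suc i))

ΣOver : ∀ {n} → VSet n → (Fin n → ℕ) → ℕ
ΣOver {n} S f = ΣFin n (λ v → if S v then f v else 0)

∣_∣ₛ : ∀ {n} → VSet n → ℕ
∣ S ∣ₛ = ΣOver S (λ _ → 1)

cost : ∀ {n} → (Fin n → ℕ) → VSet n → ℕ
cost c X = ΣOver X c

AdjExactlyOne : ∀ {n} → Graph n → Fin n → Fin n → Fin n → Set
AdjExactlyOne H w u v = (Adj H w u × ¬ Adj H w v) ⊎ (¬ Adj H w u × Adj H w v)

-- Distinguishing P3 on (u, v, w): uv an edge, w adjacent to exactly one of u, v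
-- (w is then automatically distinct from u and v, by irreflexivity);
-- this is exactly an induced P3 containing the edge uv.
DistP3 : ∀ {n} → Graph n → Fin n → Fin n → Fin n → Set
DistP3 H u v w = Adj H u v × AdjExactlyOne H w u v

HitsAllDistP3 : ∀ {n} → Graph n → VSet n → Set
HitsAllDistP3 H X = ∀ u v w → DistP3 H u v w → u ∈ₛ X ⊎ v ∈ₛ X ⊎ w ∈ₛ X

InducedP3 : ∀ {n} → Graph n → Fin n → Fin n → Fin n → Set
InducedP3 H a b c = Adj H a b × Adj H b c × ¬ Adj H a c × a ≢ c

HittingSet : ∀ {n} → Graph n → VSet n → Set
HittingSet H X = ∀ a b c → a ∉ₛ X → b ∉ₛ X → c ∉ₛ X → ¬ InducedP3 H a b c

OPT≥ : ∀ {n} → Graph n → (Fin n → ℕ) → ℕ → Set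
OPT≥ H c k = ∀ X → HittingSet H X → cost c X ≥ k

IsClique : ∀ {n} → Graph n → VSet n → Set
IsClique H C = ∀ u v → u ∈ₛ C → v ∈ₛ C → u ≢ v → Adj H u v

compl : ∀ {n} → VSet n → VSet n
compl C v = if C v then false else true

module Submission where

-- Split C recursively: a set S ⊆ C with two distinct vertices u, v is cut,
-- by a vertex w ∉ C telling u and v apart, into the neighbours and the
-- non-neighbours of w in S, both nonempty.  The splitting vertices are the
-- internal nodes of a binary tree with leaves C, so giving each of them
-- weight 1 costs |C| − 1 in total.  If X meets every distinguishing P₃, then
-- at every node where both sides keep a vertex outside X the splitting vertex
-- lies in X; by induction over the tree X pays at least |S ∖ X| − 1 for S,
-- and the unit weights on C ∩ X make up the rest of |C| − 1.

open import Defs hiding (sym)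
open import Algebra.Bundles using (CommutativeMonoid)
open import Data.Bool using (true; false; _∧_; not; if_then_else_)
open import Data.Bool.Properties
  using (∧-conicalˡ; ∧-conicalʳ; ∧-commutativeMonoid; not-injective; ¬-not)
open import Data.Empty using (⊥)
open import Data.Fin using (Fin; zero; suc)
open import Data.Fin.Properties using (_≟_; suc-injective)
open import Data.Nat using (ℕ; zero; suc; _+_; _∸_; _≤_; _≥_; z≤n; s≤s; _≤?_)
open import Data.Nat.Properties
  using ( +-0-commutativeMonoid; +-suc; +-identityʳ; +-mono-≤; +-monoʳ-≤
        ; m≤m+n; m≤n+m; m≤n+m∸n; m≤n+o⇒m∸n≤o; m≤n⇒m∸n≡0; m<m+n; m<n+m
        ; ≤-trans; ≤-reflexive; ≤-pred; <-≤-trans; ≰⇒>; module ≤-Reasoning)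
open import Data.Product using (_×_; Σ; ∃; ∃₂; ∃-syntax; _,_; proj₁; proj₂)
open import Data.Sum using (inj₁; inj₂)
open import Function using (_∘_)
open import Relation.Nullary using (¬_; yes; no; does; contradiction)
open import Relation.Nullary.Decidable using (dec-true; dec-false)
open import Relation.Binary.PropositionalEquality
  using (_≡_; _≢_; _≗_; refl; sym; trans; cong; cong₂; module ≡-Reasoning)

open import Algebra.Properties.CommutativeMonoid.Sum +-0-commutativeMonoid
  using (sum; sum-cong-≗; ∑-distrib-+; sum-replicate-zero)
open import Algebra.Properties.CommutativeSemigroup
  (CommutativeMonoid.commutativeSemigroup ∧-commutativeMonoid)
  using (xy∙z≈xz∙y)

private
  variable
    n : ℕ

infixl 30 _∩_ _─_

_∩_ : VSet n → VSet n → VSet n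
(S ∩ T) v = S v ∧ T v

_─_ : VSet n → VSet n → VSet n
(S ─ T) v = S v ∧ not (T v)

_⊆_ : VSet n → VSet n → Set
S ⊆ T = ∀ v → v ∈ₛ S → v ∈ₛ T

｛_｝ : Fin n → VSet n
｛ w ｝ v = does (v ≟ w)

𝟙 : VSet n → Fin n → ℕ
𝟙 S v = if S v then 1 else 0

nbhd : Graph n → Fin n → VSet n
nbhd H w v = does (adj? H w v)

ΣFin≡sum : ∀ n (f : Fin n → ℕ) → ΣFin n f ≡ sum f
ΣFin≡sum zero    f = refl
ΣFin≡sum (suc n) f = cong (f zero +_) (ΣFin≡sum n (f ∘ suc))

ΣFin-cong : ∀ {f g : Fin n → ℕ} → f ≗ g → ΣFin n f ≡ ΣFin n g
ΣFin-cong {n} {f} {g} f≗g = begin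
  ΣFin n f ≡⟨ ΣFin≡sum n f ⟩
  sum f    ≡⟨ sum-cong-≗ f≗g ⟩
  sum g    ≡⟨ ΣFin≡sum n g ⟨
  ΣFin n g ∎
  where open ≡-Reasoning

ΣFin-+ : ∀ (f g : Fin n → ℕ) → ΣFin n (λ v → f v + g v) ≡ ΣFin n f + ΣFin n g
ΣFin-+ {n} f g = begin
  ΣFin n (λ v → f v + g v) ≡⟨ ΣFin≡sum n _ ⟩
  sum (λ v → f v + g v)    ≡⟨ ∑-distrib-+ f g ⟩
  sum f + sum g            ≡⟨ cong₂ _+_ (ΣFin≡sum n f) (ΣFin≡sum n g) ⟨
  ΣFin n f + ΣFin n g      ∎
  where open ≡-Reasoning

ΣFin-zero : ∀ n → ΣFin n (λ _ → 0) ≡ 0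
ΣFin-zero n = trans (ΣFin≡sum n _) (sum-replicate-zero n)

cost-+ : ∀ (f g : Fin n → ℕ) X → cost (λ v → f v + g v) X ≡ cost f X + cost g X
cost-+ f g X = trans (ΣFin-cong if-+) (ΣFin-+ (λ v → if X v then f v else 0) _)
  where
  if-+ : ∀ v → (if X v then f v + g v else 0) ≡ (if X v then f v else 0) + (if X v then g v else 0)
  if-+ v with X v
  ... | true  = refl
  ... | false = refl

cost-𝟙 : ∀ (S X : VSet n) → cost (𝟙 S) X ≡ ∣ S ∩ X ∣ₛ
cost-𝟙 S X = ΣFin-cong if-𝟙
  where
  if-𝟙 : ∀ v → (if X v then 𝟙 S v else 0) ≡ 𝟙 (S ∩ X) v
  if-𝟙 v with S v | X v
  ... | true  | true  = refl
  ... | true  | false = refl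
  ... | false | true  = refl
  ... | false | false = refl

∣∣-cong : ∀ {S T : VSet n} → S ≗ T → ∣ S ∣ₛ ≡ ∣ T ∣ₛ
∣∣-cong S≗T = ΣFin-cong (cong (λ b → if b then 1 else 0) ∘ S≗T)

𝟙-∈ : ∀ (S : VSet n) {v} → v ∈ₛ S → 𝟙 S v ≡ 1
𝟙-∈ S v∈S = cong (λ b → if b then 1 else 0) v∈S

𝟙-∉ : ∀ (S : VSet n) {v} → v ∉ₛ S → 𝟙 S v ≡ 0
𝟙-∉ S v∉S = cong (λ b → if b then 1 else 0) v∉S

∣∣-split : ∀ (S T : VSet n) → ∣ S ∣ₛ ≡ ∣ S ∩ T ∣ₛ + ∣ S ─ T ∣ₛ
∣∣-split S T = trans (ΣFin-cong 𝟙-split) (ΣFin-+ (𝟙 (S ∩ T)) (𝟙 (S ─ T)))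
  where
  𝟙-split : ∀ v → 𝟙 S v ≡ 𝟙 (S ∩ T) v + 𝟙 (S ─ T) v
  𝟙-split v with S v | T v
  ... | true  | true  = refl
  ... | true  | false = refl
  ... | false | _     = refl

∣─∣-split : ∀ (S T X : VSet n) → ∣ S ─ X ∣ₛ ≡ ∣ S ∩ T ─ X ∣ₛ + ∣ S ─ T ─ X ∣ₛ
∣─∣-split S T X = trans (∣∣-split (S ─ X) T) (cong₂ _+_ (∣∣-cong (swap T)) (∣∣-cong (swap (not ∘ T))))
  where
  swap : ∀ (T′ : VSet _) v → (S v ∧ not (X v)) ∧ T′ v ≡ (S v ∧ T′ v) ∧ not (X v)
  swap T′ v = xy∙z≈xz∙y (S v) (not (X v)) (T′ v)

∣｛w｝∣≡1 : ∀ (w : Fin n) → ∣ ｛ w ｝ ∣ₛ ≡ 1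
∣｛w｝∣≡1 {suc n} zero    = cong suc (ΣFin-zero n)
∣｛w｝∣≡1 {suc n} (suc w) = ∣｛w｝∣≡1 w

∈⇒1≤∣∣ : ∀ (S : VSet n) {v} → v ∈ₛ S → 1 ≤ ∣ S ∣ₛ
∈⇒1≤∣∣ {suc n} S {zero}  v∈S rewrite v∈S = s≤s z≤n
∈⇒1≤∣∣ {suc n} S {suc v} v∈S = ≤-trans (∈⇒1≤∣∣ (S ∘ suc) v∈S) (m≤n+m _ (𝟙 S zero))

1≤∣∣⇒∃∈ : ∀ (S : VSet n) → 1 ≤ ∣ S ∣ₛ → ∃ (_∈ₛ S)
1≤∣∣⇒∃∈ {suc n} S 1≤∣S∣ with S zero in S₀
... | true  = zero , S₀
... | false with 1≤∣∣⇒∃∈ (S ∘ suc) 1≤∣S∣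
...   | v , v∈S = suc v , v∈S

2≤∣∣⇒∃≢ : ∀ (S : VSet n) → 2 ≤ ∣ S ∣ₛ → ∃₂ λ u v → u ∈ₛ S × v ∈ₛ S × u ≢ v
2≤∣∣⇒∃≢ {suc n} S 2≤∣S∣ with S zero in S₀
... | true with 1≤∣∣⇒∃∈ (S ∘ suc) (≤-pred 2≤∣S∣)
...   | v , v∈S = zero , suc v , S₀ , v∈S , λ ()
2≤∣∣⇒∃≢ {suc n} S 2≤∣S∣ | false with 2≤∣∣⇒∃≢ (S ∘ suc) 2≤∣S∣
...   | u , v , u∈S , v∈S , u≢v = suc u , suc v , u∈S , v∈S , u≢v ∘ suc-injective

∈-∩⁺ : ∀ (S T : VSet n) {v} → v ∈ₛ S → v ∈ₛ T → v ∈ₛ S ∩ T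
∈-∩⁺ _ _ v∈S v∈T = cong₂ _∧_ v∈S v∈T

∈-─⁺ : ∀ (S T : VSet n) {v} → v ∈ₛ S → v ∉ₛ T → v ∈ₛ S ─ T
∈-─⁺ _ _ v∈S v∉T = cong₂ _∧_ v∈S (cong not v∉T)

∈-∩⁻ : ∀ (S T : VSet n) {v} → v ∈ₛ S ∩ T → v ∈ₛ S × v ∈ₛ T
∈-∩⁻ S T {v} p = ∧-conicalˡ (S v) (T v) p , ∧-conicalʳ (S v) (T v) p

∈-─⁻ : ∀ (S T : VSet n) {v} → v ∈ₛ S ─ T → v ∈ₛ S × v ∉ₛ T
∈-─⁻ S T {v} p = ∧-conicalˡ (S v) _ p , not-injective (∧-conicalʳ (S v) _ p)

∈-∉⇒≢ : ∀ {S : VSet n} {u v} → u ∈ₛ S → v ∉ₛ S → u ≢ v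
∈-∉⇒≢ u∈S v∉S refl = contradiction (trans (sym u∈S) v∉S) λ ()

w∈｛w｝ : ∀ (w : Fin n) → w ∈ₛ ｛ w ｝
w∈｛w｝ w = dec-true (w ≟ w) refl

module _ (H : Graph n) where

  ∈-nbhd⁺ : ∀ {w v} → Adj H w v → v ∈ₛ nbhd H w
  ∈-nbhd⁺ {w} {v} = dec-true (adj? H w v)

  ∉-nbhd⁺ : ∀ {w v} → ¬ Adj H w v → v ∉ₛ nbhd H w
  ∉-nbhd⁺ {w} {v} = dec-false (adj? H w v)

  ∈-nbhd⁻ : ∀ {w v} → v ∈ₛ nbhd H w → Adj H w v
  ∈-nbhd⁻ {w} {v} v∈N with adj? H w v
  ... | yes a = a

  ∉-nbhd⁻ : ∀ {w v} → v ∉ₛ nbhd H w → ¬ Adj H w v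
  ∉-nbhd⁻ {w} {v} v∉N with adj? H w v
  ... | no ¬a = ¬a

  separator-splits : ∀ (S : VSet n) {u v w} → u ∈ₛ S → v ∈ₛ S → AdjExactlyOne H w u v →
                     1 ≤ ∣ S ∩ nbhd H w ∣ₛ × 1 ≤ ∣ S ─ nbhd H w ∣ₛ
  separator-splits S {w = w} u∈S v∈S (inj₁ (wu , ¬wv)) =
    ∈⇒1≤∣∣ (S ∩ N) (∈-∩⁺ S N u∈S (∈-nbhd⁺ wu)) , ∈⇒1≤∣∣ (S ─ N) (∈-─⁺ S N v∈S (∉-nbhd⁺ ¬wv))
    where N = nbhd H w
  separator-splits S {w = w} u∈S v∈S (inj₂ (¬wu , wv)) =
    ∈⇒1≤∣∣ (S ∩ N) (∈-∩⁺ S N v∈S (∈-nbhd⁺ wv)) , ∈⇒1≤∣∣ (S ─ N) (∈-─⁺ S N u∈S (∉-nbhd⁺ ¬wu))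
    where N = nbhd H w

+-∸1 : ∀ {a b} → 1 ≤ a → 1 ≤ b → suc ((a ∸ 1) + (b ∸ 1)) ≡ (a + b) ∸ 1
+-∸1 {suc a} {suc b} _ _ = sym (+-suc a b)

+-∸1-≤ : ∀ a b {c₁ c₂ d} → (1 ≤ a → 1 ≤ b → 1 ≤ d) →
         a ∸ 1 ≤ c₁ → b ∸ 1 ≤ c₂ → (a + b) ∸ 1 ≤ d + (c₁ + c₂)
+-∸1-≤ zero    b       {c₁} {c₂} {d} _ _ b≤ = ≤-trans b≤ (≤-trans (m≤n+m c₂ c₁) (m≤n+m _ d))
+-∸1-≤ (suc a) zero    {c₁} {c₂} {d} _ a≤ _ =
  ≤-trans (≤-reflexive (+-identityʳ a)) (≤-trans a≤ (≤-trans (m≤m+n c₁ c₂) (m≤n+m _ d)))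
+-∸1-≤ (suc a) (suc b) 1≤d a≤ b≤ =
  ≤-trans (≤-reflexive (+-suc a b)) (+-mono-≤ (1≤d (s≤s z≤n) (s≤s z≤n)) (+-mono-≤ a≤ b≤))

+-∸1-monoʳ : ∀ p {q r} → q ∸ 1 ≤ r → (p + q) ∸ 1 ≤ p + r
+-∸1-monoʳ p {q} {r} q∸1≤r = m≤n+o⇒m∸n≤o (p + q) 1 (begin
  p + q             ≤⟨ +-monoʳ-≤ p (m≤n+m∸n q 1) ⟩
  p + suc (q ∸ 1)   ≤⟨ +-monoʳ-≤ p (s≤s q∸1≤r) ⟩
  p + suc r         ≡⟨ +-suc p r ⟩
  suc (p + r)       ∎)
  where open ≤-Reasoning

SeparatedFromOutside : Graph n → VSet n → Set
SeparatedFromOutside H C =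
  ∀ u v → u ∈ₛ C → v ∈ₛ C → u ≢ v → ∃[ w ] (w ∉ₛ C × AdjExactlyOne H w u v)

CoversSeparators : Graph n → VSet n → VSet n → Set
CoversSeparators H C X = ∀ u v w → u ∈ₛ C → v ∈ₛ C → u ∉ₛ X → v ∉ₛ X → u ≢ v →
                         w ∉ₛ C → AdjExactlyOne H w u v → w ∈ₛ X

module _ (H : Graph n) (C : VSet n) where

  record SeparatorWeight (S : VSet n) : Set where
    field
      weight       : Fin n → ℕ
      weight-on-C  : ∀ v → v ∈ₛ C → weight v ≡ 0
      weight-total : ΣFin n weight ≡ ∣ S ∣ₛ ∸ 1
      weight-bound : ∀ X → CoversSeparators H C X → ∣ S ─ X ∣ₛ ∸ 1 ≤ cost weight X

  zeroWeight : ∀ {S} → ∣ S ∣ₛ ≤ 1 → SeparatorWeight S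
  zeroWeight {S} ∣S∣≤1 = record
    { weight       = λ _ → 0
    ; weight-on-C  = λ _ _ → refl
    ; weight-total = trans (ΣFin-zero n) (sym (m≤n⇒m∸n≡0 ∣S∣≤1))
    ; weight-bound = λ X _ → ≤-trans (≤-reflexive (m≤n⇒m∸n≡0 (∣S─X∣≤1 X))) z≤n
    }
    where
    ∣S─X∣≤1 : ∀ X → ∣ S ─ X ∣ₛ ≤ 1
    ∣S─X∣≤1 X = ≤-trans (m≤n+m _ ∣ S ∩ X ∣ₛ) (≤-trans (≤-reflexive (sym (∣∣-split S X))) ∣S∣≤1)

  splitWeight : ∀ {S} w → S ⊆ C → w ∉ₛ C →
                1 ≤ ∣ S ∩ nbhd H w ∣ₛ → 1 ≤ ∣ S ─ nbhd H w ∣ₛ →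
                SeparatorWeight (S ∩ nbhd H w) → SeparatorWeight (S ─ nbhd H w) →
                SeparatorWeight S
  splitWeight {S} w S⊆C w∉C 1≤∣S∩N∣ 1≤∣S─N∣ W₁ W₂ = record
    { weight       = f
    ; weight-on-C  = f-on-C
    ; weight-total = f-total
    ; weight-bound = f-bound
    }
    where
    N = nbhd H w
    module W₁ = SeparatorWeight W₁
    module W₂ = SeparatorWeight W₂

    f : Fin n → ℕ
    f v = 𝟙 ｛ w ｝ v + (W₁.weight v + W₂.weight v)

    f-on-C : ∀ v → v ∈ₛ C → f v ≡ 0
    f-on-C v v∈C = cong₂ _+_
      (𝟙-∉ ｛ w ｝ {v} (dec-false (v ≟ w) (∈-∉⇒≢ v∈C w∉C)))
      (cong₂ _+_ (W₁.weight-on-C v v∈C) (W₂.weight-on-C v v∈C))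

    f-total : ΣFin n f ≡ ∣ S ∣ₛ ∸ 1
    f-total = begin
      ΣFin n f
        ≡⟨ trans (ΣFin-+ (𝟙 ｛ w ｝) _) (cong (∣ ｛ w ｝ ∣ₛ +_) (ΣFin-+ W₁.weight W₂.weight)) ⟩
      ∣ ｛ w ｝ ∣ₛ + (ΣFin n W₁.weight + ΣFin n W₂.weight)
        ≡⟨ cong₂ _+_ (∣｛w｝∣≡1 w) (cong₂ _+_ W₁.weight-total W₂.weight-total) ⟩
      suc ((∣ S ∩ N ∣ₛ ∸ 1) + (∣ S ─ N ∣ₛ ∸ 1))
        ≡⟨ +-∸1 1≤∣S∩N∣ 1≤∣S─N∣ ⟩
      (∣ S ∩ N ∣ₛ + ∣ S ─ N ∣ₛ) ∸ 1
        ≡⟨ cong (_∸ 1) (∣∣-split S N) ⟨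
      ∣ S ∣ₛ ∸ 1 ∎
      where open ≡-Reasoning

    w-paid : ∀ X → CoversSeparators H C X →
             1 ≤ ∣ S ∩ N ─ X ∣ₛ → 1 ≤ ∣ S ─ N ─ X ∣ₛ → 1 ≤ cost (𝟙 ｛ w ｝) X
    w-paid X cover p q with 1≤∣∣⇒∃∈ (S ∩ N ─ X) p | 1≤∣∣⇒∃∈ (S ─ N ─ X) q
    ... | x , x∈ | y , y∈ = ≤-trans (∈⇒1≤∣∣ (｛ w ｝ ∩ X) w∈｛w｝∩X) (≤-reflexive (sym (cost-𝟙 ｛ w ｝ X)))
      where
      x∈S∩N = proj₁ (∈-─⁻ (S ∩ N) X x∈)
      y∈S─N = proj₁ (∈-─⁻ (S ─ N) X y∈)
      wx : Adj H w x
      wx = ∈-nbhd⁻ H (proj₂ (∈-∩⁻ S N x∈S∩N))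
      ¬wy : ¬ Adj H w y
      ¬wy = ∉-nbhd⁻ H (proj₂ (∈-─⁻ S N y∈S─N))
      w∈｛w｝∩X : w ∈ₛ ｛ w ｝ ∩ X
      w∈｛w｝∩X = ∈-∩⁺ ｛ w ｝ X (w∈｛w｝ w)
        (cover x y w (S⊆C x (proj₁ (∈-∩⁻ S N x∈S∩N))) (S⊆C y (proj₁ (∈-─⁻ S N y∈S─N)))
               (proj₂ (∈-─⁻ (S ∩ N) X x∈)) (proj₂ (∈-─⁻ (S ─ N) X y∈))
               (λ { refl → ¬wy wx }) w∉C (inj₁ (wx , ¬wy)))

    f-bound : ∀ X → CoversSeparators H C X → ∣ S ─ X ∣ₛ ∸ 1 ≤ cost f X
    f-bound X cover = begin
      ∣ S ─ X ∣ₛ ∸ 1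
        ≡⟨ cong (_∸ 1) (∣─∣-split S N X) ⟩
      (∣ S ∩ N ─ X ∣ₛ + ∣ S ─ N ─ X ∣ₛ) ∸ 1
        ≤⟨ +-∸1-≤ _ _ (w-paid X cover) (W₁.weight-bound X cover) (W₂.weight-bound X cover) ⟩
      cost (𝟙 ｛ w ｝) X + (cost W₁.weight X + cost W₂.weight X)
        ≡⟨ trans (cost-+ (𝟙 ｛ w ｝) _ X) (cong (cost (𝟙 ｛ w ｝) X +_) (cost-+ W₁.weight W₂.weight X)) ⟨
      cost f X ∎
      where open ≤-Reasoning

  separatorWeight : SeparatedFromOutside H C → ∀ k {S} → S ⊆ C → ∣ S ∣ₛ ≤ k → SeparatorWeight S
  separatorWeight separated zero    S⊆C ∣S∣≤0 = zeroWeight (≤-trans ∣S∣≤0 z≤n)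
  separatorWeight separated (suc k) {S} S⊆C ∣S∣≤1+k with 2 ≤? ∣ S ∣ₛ
  ... | no  ∣S∣≱2 = zeroWeight (≤-pred (≰⇒> ∣S∣≱2))
  ... | yes 2≤∣S∣ with 2≤∣∣⇒∃≢ S 2≤∣S∣
  ...   | u , v , u∈S , v∈S , u≢v with separated u v (S⊆C u u∈S) (S⊆C v v∈S) u≢v
  ...     | w , w∉C , w-separates = splitWeight w S⊆C w∉C 1≤∣S∩N∣ 1≤∣S─N∣
              (separatorWeight separated k (λ x x∈ → S⊆C x (proj₁ (∈-∩⁻ S N x∈))) ∣S∩N∣≤k)
              (separatorWeight separated k (λ x x∈ → S⊆C x (proj₁ (∈-─⁻ S N x∈))) ∣S─N∣≤k)
    where
    N = nbhd H w
    sides = separator-splits H S u∈S v∈S w-separates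
    1≤∣S∩N∣ = proj₁ sides
    1≤∣S─N∣ = proj₂ sides
    ∣S∣≡ : ∣ S ∣ₛ ≡ ∣ S ∩ N ∣ₛ + ∣ S ─ N ∣ₛ
    ∣S∣≡ = ∣∣-split S N
    ∣S∩N∣≤k : ∣ S ∩ N ∣ₛ ≤ k
    ∣S∩N∣≤k = ≤-pred (<-≤-trans (m<m+n _ 1≤∣S─N∣) (≤-trans (≤-reflexive (sym ∣S∣≡)) ∣S∣≤1+k))
    ∣S─N∣≤k : ∣ S ─ N ∣ₛ ≤ k
    ∣S─N∣≤k = ≤-pred (<-≤-trans (m<n+m _ 1≤∣S∩N∣) (≤-trans (≤-reflexive (sym ∣S∣≡)) ∣S∣≤1+k))

module _ (H : Graph n) {C : VSet n} (clique : IsClique H C) where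

  hitsAllDistP3⇒coversSeparators : ∀ X → HitsAllDistP3 H X → CoversSeparators H C X
  hitsAllDistP3⇒coversSeparators X hits u v w u∈C v∈C u∉X v∉X u≢v _ w-separates
    with hits u v w (clique u v u∈C v∈C u≢v , w-separates)
  ... | inj₁ u∈X        = contradiction (trans (sym u∈X) u∉X) λ ()
  ... | inj₂ (inj₁ v∈X) = contradiction (trans (sym v∈X) v∉X) λ ()
  ... | inj₂ (inj₂ w∈X) = w∈X

  hittingSet⇒coversSeparators : ∀ X → HittingSet H X → CoversSeparators H C X
  hittingSet⇒coversSeparators X hitting u v w u∈C v∈C u∉X v∉X u≢v w∉C w-separates =
    ¬-not (λ w∉X → induced-P3 w∉X w-separates)
    where
    uv : Adj H u v
    uv = clique u v u∈C v∈C u≢v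
    induced-P3 : w ∉ₛ X → AdjExactlyOne H w u v → ⊥
    induced-P3 w∉X (inj₁ (wu , ¬wv)) =
      hitting w u v w∉X u∉X v∉X (wu , uv , ¬wv , ∈-∉⇒≢ v∈C w∉C ∘ sym)
    induced-P3 w∉X (inj₂ (¬wu , wv)) =
      hitting u v w u∉X v∉X w∉X (uv , Graph.sym H wv , ¬wu ∘ Graph.sym H , ∈-∉⇒≢ u∈C w∉C)

lemma3 : ∀ {n} (H : Graph n) (C : VSet n) →
    IsClique H C →
    (∀ u v → u ∈ₛ C → v ∈ₛ C → u ≢ v →
      ∃[ w ] (w ∉ₛ C × AdjExactlyOne H w u v)) →
    Σ (Fin n → ℕ) λ c →
      (∀ v → v ∈ₛ C → c v ≡ 1) ×
      (ΣOver (compl C) c ≡ ∣ C ∣ₛ ∸ 1) ×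
      (∀ X → HitsAllDistP3 H X → cost c X ≥ ∣ C ∣ₛ ∸ 1) ×
      OPT≥ H c (∣ C ∣ₛ ∸ 1)
lemma3 {n} H C clique separated =
  c , c-on-C , c-on-compl ,
  (λ X → c-bound X ∘ hitsAllDistP3⇒coversSeparators H clique X) ,
  (λ X → c-bound X ∘ hittingSet⇒coversSeparators H clique X)
  where
  open SeparatorWeight (separatorWeight H C separated ∣ C ∣ₛ (λ _ v∈C → v∈C) (≤-reflexive refl))

  c : Fin n → ℕ
  c v = 𝟙 C v + weight v

  c-on-C : ∀ v → v ∈ₛ C → c v ≡ 1
  c-on-C v v∈C = cong₂ _+_ (𝟙-∈ C v∈C) (weight-on-C v v∈C)

  c-on-compl : ΣOver (compl C) c ≡ ∣ C ∣ₛ ∸ 1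
  c-on-compl = trans (ΣFin-cong c≡weight) weight-total
    where
    c≡weight : ∀ v → (if compl C v then c v else 0) ≡ weight v
    c≡weight v with C v in v∈C
    ... | true  = sym (weight-on-C v v∈C)
    ... | false = refl

  c-bound : ∀ X → CoversSeparators H C X → ∣ C ∣ₛ ∸ 1 ≤ cost c X
  c-bound X cover = begin
    ∣ C ∣ₛ ∸ 1                       ≡⟨ cong (_∸ 1) (∣∣-split C X) ⟩
    (∣ C ∩ X ∣ₛ + ∣ C ─ X ∣ₛ) ∸ 1    ≤⟨ +-∸1-monoʳ ∣ C ∩ X ∣ₛ (weight-bound X cover) ⟩
    ∣ C ∩ X ∣ₛ + cost weight X       ≡⟨ trans (cost-+ (𝟙 C) weight X) (cong (_+ cost weight X) (cost-𝟙 C X)) ⟨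
    cost c X                         ∎
    where open ≤-Reasoning
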